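{- If there exists an antipodal $k$-splitting of $Q_2^n$, then there exists an antipodal $k$-splitting of $Q_2^{n+1}$.
   Context: $Q_2^n=\{0,1\}^n$. An $m$-face of $Q_2^n$ is a tuple $a\in\{0,1,*\}^n$ with exactly $m$ entries $*$, identified with $\{x\in Q_2^n: x_i=a_i$ whenever $a_i\in\{0,1\}\}$. Faces are parallel if their sets of $*$-positions coincide; parallel faces $a,b$ are antipodal if $b_i=1-a_i$ whenever $a_i\ne*$. An antipodal $k$-splitting of $Q_2^n$ is a collection of exactly $2^k$ $(n-k)$-faces whose union is $Q_2^n$ and which contains no two distinct parallel non-antipodal faces. -}

module Defs where

open import Data.Nat using (ℕ; _^_; _∸_)
open import Data.Bool using (Bool; true; false; not)
open import Data.Fin using (Fin)
open import Data.Vec using (Vec; lookup; count)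
open import Data.List using (List; length)
open import Data.List.Membership.Propositional using (_∈_)
open import Data.List.Relation.Unary.Unique.Propositional using (Unique)
open import Data.Product using (Σ; _×_; ∃)
open import Relation.Binary.PropositionalEquality using (_≡_; refl)
open import Relation.Nullary using (¬_; Dec; yes; no)

-- Entries of a face: a fixed coordinate value (fix b) or a free coordinate (*).
data Sym : Set where
  fix  : Bool → Sym
  star : Sym

isStar : Sym → Bool
isStar (fix _) = false
isStar star    = true

Point : ℕ → Set
Point n = Vec Bool n

Face : ℕ → Set
Face n = Vec Sym n

isStar? : (s : Sym) → Dec (isStar s ≡ true)
isStar? (fix _) = no (λ ())
isStar? star    = yes refl

dim : ∀ {n} → Face n → ℕ
dim a = count isStar? a

_∈F_ : ∀ {n} → Point n → Face n → Set
_∈F_ {n} x a = ∀ (i : Fin n) (b : Bool) → lookup a i ≡ fix b → lookup x i ≡ b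

Parallel : ∀ {n} → Face n → Face n → Set
Parallel {n} a b = ∀ (i : Fin n) → (lookup a i ≡ star → lookup b i ≡ star)
                                 × (lookup b i ≡ star → lookup a i ≡ star)

Antipodal : ∀ {n} → Face n → Face n → Set
Antipodal {n} a b = Parallel a b
  × (∀ (i : Fin n) (c : Bool) → lookup a i ≡ fix c → lookup b i ≡ fix (not c))

record AntipodalSplitting (n k : ℕ) (F : List (Face n)) : Set where
  field
    distinct   : Unique F
    size       : length F ≡ 2 ^ k
    faceDim    : ∀ {a} → a ∈ F → dim a ≡ n ∸ k
    covers     : ∀ (x : Point n) → ∃ λ a → a ∈ F × x ∈F a
    antipodal  : ∀ {a b} → a ∈ F → b ∈ F → ¬ (a ≡ b) → Parallel a b → Antipodal a b

-- Adding a free coordinate turns every face a of Q_2^n into the face * a of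
-- Q_2^(n+1), and this preserves covering, parallelism and antipodality; the
-- dimension count n+1-k = (n-k)+1 holds as long as k ≤ n. The remaining case
-- k > n is impossible: all faces are then points, hence pairwise parallel and so
-- pairwise antipodal, but a point has only one antipode, so a splitting has at
-- most two faces, while 2^k ≥ 2^(n+1) and Q_2^0 has only one point.
module Submission where

open import Defs
open import Data.Nat using (ℕ; zero; suc; _≤_; _<_; _∸_; _^_; s≤s; z≤n)
open import Data.Nat.Properties using (_≤?_; ≰⇒>; <⇒≤; ≤-trans; ^-monoʳ-≤; +-∸-assoc; m≤n⇒m∸n≡0)
open import Data.Bool using (not)
open import Data.Fin using () renaming (zero to fzero; suc to fsuc)
open import Data.Vec using ([]; _∷_; lookup)
open import Data.List using (List; length; map) renaming ([] to ε; _∷_ to _◂_)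
open import Data.List.Properties using (length-map)
open import Data.List.Membership.Propositional using (_∈_)
open import Data.List.Membership.Propositional.Properties using (∈-map⁺; ∈-map⁻)
open import Data.List.Relation.Unary.Any using (here; there)
open import Data.List.Relation.Unary.All using (_∷_)
open import Data.List.Relation.Unary.AllPairs using (_∷_)
open import Data.List.Relation.Unary.Unique.Propositional using (Unique)
import Data.List.Relation.Unary.Unique.Propositional.Properties as Unique
open import Data.Product using (∃; _×_; _,_; proj₁)
open import Data.Empty using (⊥-elim)
open import Relation.Nullary using (¬_; yes; no)
open import Relation.Binary.PropositionalEquality using (_≡_; _≢_; refl; sym; trans; cong; cong₂; subst)

AntipodalFamily : ∀ {n} → List (Face n) → Set
AntipodalFamily F = ∀ {a b} → a ∈ F → b ∈ F → a ≢ b → Parallel a b → Antipodal a b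

antipodal-tail : ∀ {n} {s t} {a b : Face n} → Antipodal (s ∷ a) (t ∷ b) → Antipodal a b
antipodal-tail (p , q) = (λ i → p (fsuc i)) , (λ i → q (fsuc i))

antipode-unique : ∀ {n} {a b c : Face n} → Antipodal a b → Antipodal a c → b ≡ c
antipode-unique {a = []} {[]} {[]} _ _ = refl
antipode-unique {a = s ∷ a} {t ∷ b} {u ∷ c} ab@(pb , qb) ac@(pc , qc) =
  cong₂ _∷_ (head-unique s (proj₁ (pb fzero)) (qb fzero) (proj₁ (pc fzero)) (qc fzero))
            (antipode-unique {a = a} {b} {c} (antipodal-tail {s = s} {t} ab) (antipodal-tail {s = s} {u} ac))
  where
  head-unique : ∀ s → (s ≡ star → t ≡ star) → (∀ x → s ≡ fix x → t ≡ fix (not x))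
              → (s ≡ star → u ≡ star) → (∀ x → s ≡ fix x → u ≡ fix (not x)) → t ≡ u
  head-unique star    pt _  pu _  = trans (pt refl) (sym (pu refl))
  head-unique (fix x) _  qt _  qu = trans (qt x refl) (sym (qu x refl))

dim≡0⇒lookup≢star : ∀ {n} (a : Face n) → dim a ≡ 0 → ∀ i → lookup a i ≢ star
dim≡0⇒lookup≢star (star  ∷ a) ()
dim≡0⇒lookup≢star (fix _ ∷ a) d fzero    ()
dim≡0⇒lookup≢star (fix _ ∷ a) d (fsuc i) e = dim≡0⇒lookup≢star a d i e

dim≡0⇒parallel : ∀ {n} (a b : Face n) → dim a ≡ 0 → dim b ≡ 0 → Parallel a b
dim≡0⇒parallel a b da db i =
  (λ e → ⊥-elim (dim≡0⇒lookup≢star a da i e)) , (λ e → ⊥-elim (dim≡0⇒lookup≢star b db i e))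

unique-faces₀⇒length≤1 : (F : List (Face 0)) → Unique F → length F ≤ 1
unique-faces₀⇒length≤1 ε             _               = z≤n
unique-faces₀⇒length≤1 (_ ◂ ε)       _               = s≤s z≤n
unique-faces₀⇒length≤1 ([] ◂ [] ◂ _) ((a≢b ∷ _) ∷ _) = ⊥-elim (a≢b refl)

antipodalFamily-of-points⇒length≤2 : ∀ {n} (F : List (Face n)) → Unique F → (∀ {a} → a ∈ F → dim a ≡ 0)
                                   → AntipodalFamily F → length F ≤ 2
antipodalFamily-of-points⇒length≤2 ε             _ _ _ = z≤n
antipodalFamily-of-points⇒length≤2 (_ ◂ ε)       _ _ _ = s≤s z≤n
antipodalFamily-of-points⇒length≤2 (_ ◂ _ ◂ ε)   _ _ _ = s≤s (s≤s z≤n)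
antipodalFamily-of-points⇒length≤2 (a ◂ b ◂ c ◂ F) ((a≢b ∷ a≢c ∷ _) ∷ (b≢c ∷ _) ∷ _) point family =
  ⊥-elim (b≢c (antipode-unique {a = a} {b} {c} (antipodeOf a≢b (there (here refl)))
                                              (antipodeOf a≢c (there (there (here refl))))))
  where
  ∈a : a ∈ a ◂ b ◂ c ◂ F
  ∈a = here refl
  antipodeOf : ∀ {d} → a ≢ d → d ∈ a ◂ b ◂ c ◂ F → Antipodal a d
  antipodeOf {d} a≢d d∈ = family ∈a d∈ a≢d (dim≡0⇒parallel a d (point ∈a) (point d∈))

splitting-length≥2^[1+n] : ∀ {n k F} → n < k → AntipodalSplitting n k F → 2 ^ suc n ≤ length F
splitting-length≥2^[1+n] {n} {k} n<k S =
  subst (2 ^ suc n ≤_) (sym (AntipodalSplitting.size S)) (^-monoʳ-≤ 2 {suc n} {k} n<k)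

splitting-beyond-dimension-length≤2 : ∀ {n k F} → n < k → AntipodalSplitting n k F → length F ≤ 2
splitting-beyond-dimension-length≤2 {F = F} n<k S =
  antipodalFamily-of-points⇒length≤2 F distinct (λ a∈ → trans (faceDim a∈) (m≤n⇒m∸n≡0 (<⇒≤ n<k))) antipodal
  where open AntipodalSplitting S

no-splitting-beyond-dimension : ∀ {n k F} → n < k → ¬ AntipodalSplitting n k F
no-splitting-beyond-dimension {zero} {F = F} n<k S
  with ≤-trans (splitting-length≥2^[1+n] n<k S) (unique-faces₀⇒length≤1 F (AntipodalSplitting.distinct S))
... | s≤s ()
no-splitting-beyond-dimension {suc m} n<k S
  with ≤-trans (^-monoʳ-≤ 2 {2} {suc (suc m)} (s≤s (s≤s z≤n)))
               (≤-trans (splitting-length≥2^[1+n] n<k S) (splitting-beyond-dimension-length≤2 n<k S))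
... | s≤s (s≤s ())

splitting⇒k≤n : ∀ {n k F} → AntipodalSplitting n k F → k ≤ n
splitting⇒k≤n {n} {k} S with k ≤? n
... | yes k≤n = k≤n
... | no  k≰n = ⊥-elim (no-splitting-beyond-dimension (≰⇒> k≰n) S)

cylinder : ∀ {n} → Face n → Face (suc n)
cylinder a = star ∷ a

cylinder-injective : ∀ {n} {a b : Face n} → cylinder a ≡ cylinder b → a ≡ b
cylinder-injective refl = refl

∈F-cylinder : ∀ {n} {x : Point n} {a} b → x ∈F a → (b ∷ x) ∈F cylinder a
∈F-cylinder b x∈a fzero    _ ()
∈F-cylinder b x∈a (fsuc i) = x∈a i

parallel-cylinder : ∀ {n} {a b : Face n} → Parallel a b → Parallel (cylinder a) (cylinder b)
parallel-cylinder p fzero    = (λ _ → refl) , (λ _ → refl)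
parallel-cylinder p (fsuc i) = p i

antipodal-cylinder : ∀ {n} {a b : Face n} → Antipodal a b → Antipodal (cylinder a) (cylinder b)
antipodal-cylinder (p , q) = parallel-cylinder p , opposite
  where
  opposite : ∀ i x → lookup (cylinder _) i ≡ fix x → lookup (cylinder _) i ≡ fix (not x)
  opposite fzero    _ ()
  opposite (fsuc i) = q i

cylinder-splitting : ∀ {n k F} → AntipodalSplitting n k F → AntipodalSplitting (suc n) k (map cylinder F)
cylinder-splitting {n} {k} {F} S = record
  { distinct  = Unique.map⁺ cylinder-injective distinct
  ; size      = trans (length-map cylinder F) size
  ; faceDim   = λ a∈ → faceDim′ (∈-map⁻ cylinder a∈)
  ; covers    = covers′
  ; antipodal = λ a∈ b∈ → antipodal′ (∈-map⁻ cylinder a∈) (∈-map⁻ cylinder b∈)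
  }
  where
  open AntipodalSplitting S
  faceDim′ : ∀ {a′} → ∃ (λ a → a ∈ F × a′ ≡ cylinder a) → dim a′ ≡ suc n ∸ k
  faceDim′ (a , a∈ , refl) = trans (cong suc (faceDim a∈)) (sym (+-∸-assoc 1 (splitting⇒k≤n S)))
  covers′ : ∀ x → ∃ λ a → a ∈ map cylinder F × x ∈F a
  covers′ (b ∷ x) with covers x
  ... | a , a∈ , x∈a = cylinder a , ∈-map⁺ cylinder a∈ , ∈F-cylinder b x∈a
  antipodal′ : ∀ {a′ b′} → ∃ (λ a → a ∈ F × a′ ≡ cylinder a) → ∃ (λ b → b ∈ F × b′ ≡ cylinder b)
             → a′ ≢ b′ → Parallel a′ b′ → Antipodal a′ b′
  antipodal′ (a , a∈ , refl) (b , b∈ , refl) a′≢b′ p =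
    antipodal-cylinder (antipodal a∈ b∈ (λ a≡b → a′≢b′ (cong cylinder a≡b)) (λ i → p (fsuc i)))

proposition1 : ∀ (n k : ℕ) → (∃ λ (F : List (Face n)) → AntipodalSplitting n k F)
    → ∃ λ (G : List (Face (suc n))) → AntipodalSplitting (suc n) k G
proposition1 n k (F , S) = map cylinder F , cylinder-splitting S
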